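{- Let $a,b,c\in V$ be vectors whose images in $V/2V$ are linearly independent and which satisfy $\langle a,b\rangle=\langle b,c\rangle=-1$ and $\langle a,c\rangle=0$. Then $t_a^2\,t_{t_b(a)}^2\,t_{t_c(t_b(a))}^2\,t_b^2\,t_{t_c(b)}^2\,t_c^2=t_a^2\,t_{a-b}^2\,t_{a-b+c}^2\,t_b^2\,t_{b-c}^2\,t_c^2=t_{a+c}^2.$
   Context: $V$ is a free $\mathbb Z_2$-module of rank $2g$ equipped with an alternating $\mathbb Z_2$-bilinear form $\langle\cdot,\cdot\rangle$ whose reduction modulo $2$ is a nondegenerate form on $V/2V$. For $x\in V$, the transvection $t_x:V\to V$ is $v\mapsto v+\langle v,x\rangle x$. -}

module Defs where

open import Data.Nat using (ℕ; zero; suc)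
import Data.Nat as ℕ
open import Data.Integer as ℤ using (ℤ; +_; _+_; _-_; _*_; -_)
open import Data.Integer.Tactic.RingSolver using (solve-∀)
open import Data.Fin using (Fin)
open import Data.Product using (Σ; ∃; _,_; _×_)
open import Relation.Binary.PropositionalEquality using (_≡_; refl; trans; sym; subst; cong; cong₂)
import Data.Integer.Properties as ℤP
import Data.Fin as Fin

infix 4 _∣ℤ_
_∣ℤ_ : ℤ → ℤ → Set
d ∣ℤ z = ∃ λ k → z ≡ k * d

private
  lem+ : ∀ a b c e → (a + b) - (c + e) ≡ (a - c) + (b - e)
  lem+ = solve-∀
  lem* : ∀ a b c e → a * b - c * e ≡ a * (b - e) + (a - c) * e
  lem* = solve-∀
  lem- : ∀ a c → (- a) - (- c) ≡ (- (+ 1)) * (a - c)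
  lem- = solve-∀
  dist : ∀ k l d → k * d + l * d ≡ (k + l) * d
  dist = solve-∀
  assoc : ∀ a k d → a * (k * d) ≡ (a * k) * d
  assoc = solve-∀

∣-+ : ∀ {d x y} → d ∣ℤ x → d ∣ℤ y → d ∣ℤ x + y
∣-+ {d} (k , refl) (l , refl) = k + l , dist k l d

∣-*ˡ : ∀ {d x} a → d ∣ℤ x → d ∣ℤ a * x
∣-*ˡ {d} a (k , refl) = a * k , assoc a k d

∣-*ʳ : ∀ {d x} a → d ∣ℤ x → d ∣ℤ x * a
∣-*ʳ {d} a (k , refl) = k * a , solve-∀' k a d
  where
  solve-∀' : ∀ k a d → k * d * a ≡ k * a * d
  solve-∀' = solve-∀

-- The 2-adic integers ℤ₂ = lim ℤ/2ⁿℤ, an element being a coherent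
-- sequence of integer representatives x n of its residue mod 2ⁿ.

2^ : ℕ → ℤ
2^ n = + (2 ℕ.^ n)

record ℤ₂ : Set where
  constructor mkℤ₂
  field
    res : ℕ → ℤ
    coh : ∀ n → 2^ n ∣ℤ res (suc n) - res n
open ℤ₂ public

infix 4 _≈₂_
_≈₂_ : ℤ₂ → ℤ₂ → Set
x ≈₂ y = ∀ n → 2^ n ∣ℤ res x n - res y n

infixl 6 _+₂_ _-₂_
infixl 7 _*₂_

_+₂_ : ℤ₂ → ℤ₂ → ℤ₂
x +₂ y = mkℤ₂ (λ n → res x n + res y n) λ n →
  subst (2^ n ∣ℤ_) (sym (lem+ (res x (suc n)) (res y (suc n)) (res x n) (res y n)))
        (∣-+ (coh x n) (coh y n))

-₂_ : ℤ₂ → ℤ₂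
-₂ x = mkℤ₂ (λ n → - res x n) λ n →
  subst (2^ n ∣ℤ_) (sym (lem- (res x (suc n)) (res x n))) (∣-*ˡ (- (+ 1)) (coh x n))

_*₂_ : ℤ₂ → ℤ₂ → ℤ₂
x *₂ y = mkℤ₂ (λ n → res x n * res y n) λ n →
  subst (2^ n ∣ℤ_) (sym (lem* (res x (suc n)) (res y (suc n)) (res x n) (res y n)))
        (∣-+ (∣-*ˡ (res x (suc n)) (coh y n)) (∣-*ʳ (res y n) (coh x n)))

_-₂_ : ℤ₂ → ℤ₂ → ℤ₂
x -₂ y = x +₂ (-₂ y)

ι : ℤ → ℤ₂
ι z = mkℤ₂ (λ _ → z) λ n → + 0 , trans (ℤP.+-inverseʳ z) (sym (ℤP.*-zeroˡ (2^ n)))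

0₂ 1₂ : ℤ₂
0₂ = ι (+ 0)
1₂ = ι (+ 1)

Even₂ : ℤ₂ → Set
Even₂ x = 2^ 1 ∣ℤ res x 1

Vec₂ : ℕ → Set
Vec₂ m = Fin m → ℤ₂

module _ {m : ℕ} where

  infix 4 _≈ⱽ_
  _≈ⱽ_ : Vec₂ m → Vec₂ m → Set
  v ≈ⱽ w = ∀ i → v i ≈₂ w i

  infixl 6 _+ⱽ_ _-ⱽ_
  infixr 7 _·ⱽ_
  _+ⱽ_ _-ⱽ_ : Vec₂ m → Vec₂ m → Vec₂ m
  (v +ⱽ w) i = v i +₂ w i
  (v -ⱽ w) i = v i -₂ w i

  _·ⱽ_ : ℤ₂ → Vec₂ m → Vec₂ m
  (r ·ⱽ v) i = r *₂ v i

  In2V : Vec₂ m → Set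
  In2V v = ∀ i → Even₂ (v i)

Σ₂ : ∀ m → (Fin m → ℤ₂) → ℤ₂
Σ₂ zero    f = 0₂
Σ₂ (suc m) f = f Fin.zero +₂ Σ₂ m (λ i → f (Fin.suc i))

Gram : ℕ → Set
Gram m = Fin m → Fin m → ℤ₂

⟪_⟫ : ∀ {m} → Gram m → Vec₂ m → Vec₂ m → ℤ₂
⟪_⟫ {m} ω v w = Σ₂ m λ i → Σ₂ m λ j → v i *₂ ω i j *₂ w j

Alternating : ∀ {m} → Gram m → Set
Alternating {m} ω = ∀ (v : Vec₂ m) → ⟪ ω ⟫ v v ≈₂ 0₂

NondegMod2 : ∀ {m} → Gram m → Set
NondegMod2 {m} ω = ∀ (v : Vec₂ m) → (∀ w → Even₂ (⟪ ω ⟫ v w)) → In2V v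

LinIndepMod2 : ∀ {m} → Vec₂ m → Vec₂ m → Vec₂ m → Set
LinIndepMod2 a b c = ∀ α β γ → In2V (α ·ⱽ a +ⱽ β ·ⱽ b +ⱽ γ ·ⱽ c) →
  Even₂ α × Even₂ β × Even₂ γ

transv : ∀ {m} → Gram m → Vec₂ m → Vec₂ m → Vec₂ m
transv ω x v = v +ⱽ ⟪ ω ⟫ v x ·ⱽ x

transv² : ∀ {m} → Gram m → Vec₂ m → Vec₂ m → Vec₂ m
transv² ω x v = transv ω x (transv ω x v)

module Submission where

-- Both identities are checked modulo 2ⁿ for every n.  Read
-- mod 2ⁿ, V becomes ℤ^m with an integer bilinear form that is alternating mod
-- 2ⁿ, hence antisymmetric, so the hypotheses fix the Gram matrix G of the
-- frame (a, b, c).  Every transvection vector in the statement lies in the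
-- span of the frame, and t_y(w) = w + ⟨w,y⟩ y.  Writing w = v + αa + βb + γc,
-- the coefficients (α, β, γ) are linear in ν = (⟨v,a⟩, ⟨v,b⟩, ⟨v,c⟩), so the
-- image of v under a word of transvections is recorded by an integer 3×3
-- "state" matrix K with (α, β, γ) = K ν, and each transvection updates K by
-- the explicit rule 'step' (lemma step-▷).  Both words run through the same
-- five intermediate states and end in the state of t²_{a+c}; each step is
-- a closed matrix computation checked by refl.

open import Defs
open import Data.Nat using (ℕ; _*_)
open import Data.Integer using (+_; -_)
open import Data.Product using (_×_)
open import Function using (_∘_)

open import Data.Nat using (zero; suc)
open import Data.Integer.Base using (ℤ; _+_; _-_) renaming (_*_ to _·_)
open import Data.Integer.Properties using (+-*-semiring; +-assoc; +-identityʳ; *-comm)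
open import Data.Integer.Tactic.RingSolver using (solve-∀)
open import Data.Fin using (Fin; zero; suc)
open import Data.Product using (_,_)
open import Relation.Binary.Bundles using (Setoid)
open import Relation.Binary.PropositionalEquality
  using (_≡_; refl; sym; trans; cong; cong₂; subst; module ≡-Reasoning)
open import Algebra.Properties.Semiring.Sum +-*-semiring
  using (sum; sum-cong-≗; ∑-distrib-+; *-distribˡ-sum)

record ℤ³ : Set where
  constructor ⟨_,_,_⟩
  field
    x₁ x₂ x₃ : ℤ

infixl 6 _⊕_ _⊖_ _⊞_
infixr 7 _⊛_
infix 8 _∙_
infixr 9 _▷_ _ᵀ▷_
infix 9 _⊗_

_⊕_ _⊖_ : ℤ³ → ℤ³ → ℤ³
⟨ p , q , r ⟩ ⊕ ⟨ p' , q' , r' ⟩ = ⟨ p + p' , q + q' , r + r' ⟩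
⟨ p , q , r ⟩ ⊖ ⟨ p' , q' , r' ⟩ = ⟨ p - p' , q - q' , r - r' ⟩

_⊛_ : ℤ → ℤ³ → ℤ³
k ⊛ ⟨ p , q , r ⟩ = ⟨ k · p , k · q , k · r ⟩

_∙_ : ℤ³ → ℤ³ → ℤ
⟨ p , q , r ⟩ ∙ ⟨ p' , q' , r' ⟩ = p · p' + q · q' + r · r'

⟨⟩-cong : ∀ {p q r p' q' r'} → p ≡ p' → q ≡ q' → r ≡ r' → ⟨ p , q , r ⟩ ≡ ⟨ p' , q' , r' ⟩
⟨⟩-cong refl refl refl = refl

∙-comm : ∀ u w → u ∙ w ≡ w ∙ u
∙-comm ⟨ p , q , r ⟩ ⟨ p' , q' , r' ⟩ = identity p q r p' q' r'
  where
  identity : ∀ p q r p' q' r' → p · p' + q · q' + r · r' ≡ p' · p + q' · q + r' · r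
  identity = solve-∀

∙-distribʳ-⊕ : ∀ u w ν → (u ⊕ w) ∙ ν ≡ u ∙ ν + w ∙ ν
∙-distribʳ-⊕ ⟨ p , q , r ⟩ ⟨ p' , q' , r' ⟩ ⟨ x , y , z ⟩ = identity p q r p' q' r' x y z
  where
  identity : ∀ p q r p' q' r' x y z →
    (p + p') · x + (q + q') · y + (r + r') · z ≡ (p · x + q · y + r · z) + (p' · x + q' · y + r' · z)
  identity = solve-∀

∙-⊛ : ∀ k u ν → (k ⊛ u) ∙ ν ≡ (u ∙ ν) · k
∙-⊛ k ⟨ p , q , r ⟩ ⟨ x , y , z ⟩ = identity k p q r x y z
  where
  identity : ∀ k p q r x y z → k · p · x + k · q · y + k · r · z ≡ (p · x + q · y + r · z) · k
  identity = solve-∀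

record Mat3 : Set where
  constructor rows
  field
    row₁ row₂ row₃ : ℤ³

_▷_ : Mat3 → ℤ³ → ℤ³
rows r₁ r₂ r₃ ▷ ν = ⟨ r₁ ∙ ν , r₂ ∙ ν , r₃ ∙ ν ⟩

_ᵀ▷_ : Mat3 → ℤ³ → ℤ³
rows r₁ r₂ r₃ ᵀ▷ ⟨ w₁ , w₂ , w₃ ⟩ = w₁ ⊛ r₁ ⊕ w₂ ⊛ r₂ ⊕ w₃ ⊛ r₃

_⊗_ : ℤ³ → ℤ³ → Mat3
⟨ y₁ , y₂ , y₃ ⟩ ⊗ u = rows (y₁ ⊛ u) (y₂ ⊛ u) (y₃ ⊛ u)

_⊞_ : Mat3 → Mat3 → Mat3
rows r₁ r₂ r₃ ⊞ rows s₁ s₂ s₃ = rows (r₁ ⊕ s₁) (r₂ ⊕ s₂) (r₃ ⊕ s₃)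

0ᴹ : Mat3
0ᴹ = rows ⟨ + 0 , + 0 , + 0 ⟩ ⟨ + 0 , + 0 , + 0 ⟩ ⟨ + 0 , + 0 , + 0 ⟩

▷-⊞ : ∀ K L ν → (K ⊞ L) ▷ ν ≡ K ▷ ν ⊕ L ▷ ν
▷-⊞ (rows r₁ r₂ r₃) (rows s₁ s₂ s₃) ν =
  ⟨⟩-cong (∙-distribʳ-⊕ r₁ s₁ ν) (∙-distribʳ-⊕ r₂ s₂ ν) (∙-distribʳ-⊕ r₃ s₃ ν)

▷-⊗ : ∀ y u ν → (y ⊗ u) ▷ ν ≡ (u ∙ ν) ⊛ y
▷-⊗ ⟨ y₁ , y₂ , y₃ ⟩ u ν = ⟨⟩-cong (∙-⊛ y₁ u ν) (∙-⊛ y₂ u ν) (∙-⊛ y₃ u ν)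

ᵀ▷-adjoint : ∀ K w ν → (K ᵀ▷ w) ∙ ν ≡ (K ▷ ν) ∙ w
ᵀ▷-adjoint (rows r₁ r₂ r₃) ⟨ w₁ , w₂ , w₃ ⟩ ν = begin
  (w₁ ⊛ r₁ ⊕ w₂ ⊛ r₂ ⊕ w₃ ⊛ r₃) ∙ ν
    ≡⟨ ∙-distribʳ-⊕ (w₁ ⊛ r₁ ⊕ w₂ ⊛ r₂) (w₃ ⊛ r₃) ν ⟩
  (w₁ ⊛ r₁ ⊕ w₂ ⊛ r₂) ∙ ν + (w₃ ⊛ r₃) ∙ ν
    ≡⟨ cong (λ t → t + (w₃ ⊛ r₃) ∙ ν) (∙-distribʳ-⊕ (w₁ ⊛ r₁) (w₂ ⊛ r₂) ν) ⟩
  (w₁ ⊛ r₁) ∙ ν + (w₂ ⊛ r₂) ∙ ν + (w₃ ⊛ r₃) ∙ ν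
    ≡⟨ cong₂ _+_ (cong₂ _+_ (∙-⊛ w₁ r₁ ν) (∙-⊛ w₂ r₂ ν)) (∙-⊛ w₃ r₃ ν) ⟩
  (r₁ ∙ ν) · w₁ + (r₂ ∙ ν) · w₂ + (r₃ ∙ ν) · w₃ ∎
  where open ≡-Reasoning

-- The coordinates of t_y(k) = k + ⟨k,y⟩ y in a frame with Gram matrix G.
transvect : Mat3 → ℤ³ → ℤ³ → ℤ³
transvect G y k = k ⊕ (k ∙ (G ▷ y)) ⊛ y

-- A state K stands for the vector v + Σ (K ν)ᵢ eᵢ, where ν lists the
-- pairings of v with the frame.  'step G y K' is the state after applying t_y.
step : Mat3 → ℤ³ → Mat3 → Mat3
step G y K = K ⊞ y ⊗ (y ⊕ K ᵀ▷ (G ▷ y))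

-- Evaluated at ν, 'step' adds s y with s = ⟨v + Σ (K ν)ᵢ eᵢ , y⟩.
step-▷ : ∀ G y K ν → step G y K ▷ ν ≡ K ▷ ν ⊕ (y ∙ ν + (K ▷ ν) ∙ (G ▷ y)) ⊛ y
step-▷ G y K ν = begin
  (K ⊞ y ⊗ u) ▷ ν           ≡⟨ ▷-⊞ K (y ⊗ u) ν ⟩
  K ▷ ν ⊕ (y ⊗ u) ▷ ν       ≡⟨ cong (K ▷ ν ⊕_) (▷-⊗ y u ν) ⟩
  K ▷ ν ⊕ (u ∙ ν) ⊛ y       ≡⟨ cong (λ s → K ▷ ν ⊕ s ⊛ y) pairing ⟩
  K ▷ ν ⊕ (y ∙ ν + (K ▷ ν) ∙ (G ▷ y)) ⊛ y ∎
  where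
  open ≡-Reasoning
  u : ℤ³
  u = y ⊕ K ᵀ▷ (G ▷ y)
  pairing : u ∙ ν ≡ y ∙ ν + (K ▷ ν) ∙ (G ▷ y)
  pairing = trans (∙-distribʳ-⊕ y (K ᵀ▷ (G ▷ y)) ν) (cong (_+_ (y ∙ ν)) (ᵀ▷-adjoint K (G ▷ y) ν))

module Congruence (M : ℤ) where

  infix 4 _≋_ _≈_ _≋³_ _≋ᴹ_

  record _≋_ (x y : ℤ) : Set where
    constructor by-divisibility
    field
      divides : M ∣ℤ x - y
  open _≋_ public

  private
    via : ∀ {x y} e → x - y ≡ e → M ∣ℤ e → x ≋ y
    via e eq d = by-divisibility (subst (M ∣ℤ_) (sym eq) d)

    zero-diff : ∀ x M → x - x ≡ + 0 · M
    zero-diff = solve-∀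
    sym-diff : ∀ x y → y - x ≡ - + 1 · (x - y)
    sym-diff = solve-∀
    trans-diff : ∀ x y z → x - z ≡ (x - y) + (y - z)
    trans-diff = solve-∀
    sum-diff : ∀ x y x' y' → (x + y) - (x' + y') ≡ (x - x') + (y - y')
    sum-diff = solve-∀
    product-diff : ∀ x y x' y' → x · y - x' · y' ≡ x · (y - y') + (x - x') · y'
    product-diff = solve-∀

  ≋-reflexive : ∀ {x y} → x ≡ y → x ≋ y
  ≋-reflexive {x} refl = via _ (zero-diff x M) (+ 0 , refl)

  ≋-refl : ∀ {x} → x ≋ x
  ≋-refl = ≋-reflexive refl

  ≋-sym : ∀ {x y} → x ≋ y → y ≋ x
  ≋-sym {x} {y} p = via _ (sym-diff x y) (∣-*ˡ (- + 1) (divides p))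

  ≋-trans : ∀ {x y z} → x ≋ y → y ≋ z → x ≋ z
  ≋-trans {x} {y} {z} p q = via _ (trans-diff x y z) (∣-+ (divides p) (divides q))

  ≋-setoid : Setoid _ _
  ≋-setoid = record
    { Carrier = ℤ ; _≈_ = _≋_
    ; isEquivalence = record { refl = ≋-refl ; sym = ≋-sym ; trans = ≋-trans } }

  +-cong : ∀ {x y x' y'} → x ≋ x' → y ≋ y' → x + y ≋ x' + y'
  +-cong {x} {y} {x'} {y'} p q = via _ (sum-diff x y x' y') (∣-+ (divides p) (divides q))

  ·-cong : ∀ {x y x' y'} → x ≋ x' → y ≋ y' → x · y ≋ x' · y'
  ·-cong {x} {y} {x'} {y'} p q =
    via _ (product-diff x y x' y') (∣-+ (∣-*ˡ x (divides q)) (∣-*ʳ y' (divides p)))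

  neg-cong : ∀ {x x'} → x ≋ x' → - x ≋ - x'
  neg-cong {x} {x'} p = via _ (neg-diff x x') (∣-*ˡ (- + 1) (divides p))
    where
    neg-diff : ∀ x x' → (- x) - (- x') ≡ - + 1 · (x - x')
    neg-diff = solve-∀

  sub-cong : ∀ {x y x' y'} → x ≋ x' → y ≋ y' → x - y ≋ x' - y'
  sub-cong p q = +-cong p (neg-cong q)

  _≈_ : ∀ {m} → (Fin m → ℤ) → (Fin m → ℤ) → Set
  u ≈ w = ∀ i → u i ≋ w i

  _≋³_ : ℤ³ → ℤ³ → Set
  ⟨ p , q , r ⟩ ≋³ ⟨ p' , q' , r' ⟩ = p ≋ p' × q ≋ q' × r ≋ r'

  _≋ᴹ_ : Mat3 → Mat3 → Set
  rows r₁ r₂ r₃ ≋ᴹ rows s₁ s₂ s₃ = r₁ ≋³ s₁ × r₂ ≋³ s₂ × r₃ ≋³ s₃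

  ∙-congˡ : ∀ {u u'} → u ≋³ u' → ∀ w → u ∙ w ≋ u' ∙ w
  ∙-congˡ {⟨ _ , _ , _ ⟩} {⟨ _ , _ , _ ⟩} (p , q , r) ⟨ x , y , z ⟩ =
    +-cong (+-cong (·-cong p (≋-refl {x})) (·-cong q (≋-refl {y}))) (·-cong r (≋-refl {z}))

  ∙-congʳ : ∀ k {u u'} → u ≋³ u' → k ∙ u ≋ k ∙ u'
  ∙-congʳ ⟨ x , y , z ⟩ {⟨ _ , _ , _ ⟩} {⟨ _ , _ , _ ⟩} (p , q , r) =
    +-cong (+-cong (·-cong (≋-refl {x}) p) (·-cong (≋-refl {y}) q)) (·-cong (≋-refl {z}) r)

  ▷-cong : ∀ {K L} → K ≋ᴹ L → ∀ y → K ▷ y ≋³ L ▷ y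
  ▷-cong {rows _ _ _} {rows _ _ _} (p , q , r) y = ∙-congˡ p y , ∙-congˡ q y , ∙-congˡ r y

  sum-cong : ∀ {m} {f g : Fin m → ℤ} → f ≈ g → sum f ≋ sum g
  sum-cong {zero} h = ≋-refl
  sum-cong {suc m} h = +-cong (h zero) (sum-cong (λ i → h (suc i)))

∑∑ : ∀ {m} → (Fin m → Fin m → ℤ) → ℤ
∑∑ f = sum λ i → sum λ j → f i j

∑∑-+ : ∀ {m} {f g h : Fin m → Fin m → ℤ} → (∀ i j → f i j ≡ g i j + h i j) →
  ∑∑ f ≡ ∑∑ g + ∑∑ h
∑∑-+ {g = g} {h} split = trans
  (sum-cong-≗ λ i → trans (sum-cong-≗ (split i)) (∑-distrib-+ (g i) (h i)))
  (∑-distrib-+ (λ i → sum (g i)) (λ i → sum (h i)))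

∑∑-· : ∀ {m} k {f g : Fin m → Fin m → ℤ} → (∀ i j → f i j ≡ k · g i j) → ∑∑ f ≡ k · ∑∑ g
∑∑-· k {g = g} scale = trans
  (sum-cong-≗ λ i → trans (sum-cong-≗ (scale i)) (sym (*-distribˡ-sum k (g i))))
  (sym (*-distribˡ-sum k (λ i → sum (g i))))

∑∑-cong : ∀ M {m} {f g : Fin m → Fin m → ℤ} → (∀ i j → Congruence._≋_ M (f i j) (g i j)) →
  Congruence._≋_ M (∑∑ f) (∑∑ g)
∑∑-cong M h = sum-cong (λ i → sum-cong (h i))
  where open Congruence M

module Bilinear {m : ℕ} (W : Fin m → Fin m → ℤ) where

  form : (Fin m → ℤ) → (Fin m → ℤ) → ℤ
  form u w = ∑∑ λ i j → u i · W i j · w j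

  transvℤ : (Fin m → ℤ) → (Fin m → ℤ) → Fin m → ℤ
  transvℤ x w i = w i + form w x · x i

  private
    distribˡ : ∀ u u' e w → (u + u') · e · w ≡ u · e · w + u' · e · w
    distribˡ = solve-∀
    distribʳ : ∀ u e w w' → u · e · (w + w') ≡ u · e · w + u · e · w'
    distribʳ = solve-∀
    scaleˡ : ∀ k u e w → k · u · e · w ≡ k · (u · e · w)
    scaleˡ = solve-∀
    scaleʳ : ∀ k u e w → u · e · (k · w) ≡ k · (u · e · w)
    scaleʳ = solve-∀

  form-+ˡ : ∀ u u' w → form (λ i → u i + u' i) w ≡ form u w + form u' w
  form-+ˡ u u' w = ∑∑-+ λ i j → distribˡ (u i) (u' i) (W i j) (w j)

  form-+ʳ : ∀ u w w' → form u (λ i → w i + w' i) ≡ form u w + form u w'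
  form-+ʳ u w w' = ∑∑-+ λ i j → distribʳ (u i) (W i j) (w j) (w' j)

  form-·ˡ : ∀ k u w → form (λ i → k · u i) w ≡ k · form u w
  form-·ˡ k u w = ∑∑-· k λ i j → scaleˡ k (u i) (W i j) (w j)

  form-·ʳ : ∀ u k w → form u (λ i → k · w i) ≡ form u w · k
  form-·ʳ u k w = trans (∑∑-· k λ i j → scaleʳ k (u i) (W i j) (w j)) (*-comm k (form u w))

module BilinearModulo {m : ℕ} (W : Fin m → Fin m → ℤ) (M : ℤ) where
  open Bilinear W
  open Congruence M

  form-cong : ∀ {u u' w w'} → u ≈ u' → w ≈ w' → form u w ≋ form u' w'
  form-cong hu hw = ∑∑-cong M λ i j → ·-cong (·-cong (hu i) ≋-refl) (hw j)

  transvℤ-cong : ∀ {x x' w w'} → x ≈ x' → w ≈ w' → transvℤ x w ≈ transvℤ x' w'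
  transvℤ-cong hx hw i = +-cong (hw i) (·-cong (form-cong hw hx) (hx i))

  -- an alternating form is antisymmetric: expand ⟨u + w, u + w⟩ = 0
  form-antisym : (∀ u → form u u ≋ + 0) → ∀ u w → form w u ≋ - form u w
  form-antisym alt u w = begin
    form w u                                    ≡⟨ isolate (form u u) (form u w) (form w u) (form w w) ⟩
    ((uu + uw) + (wu + ww)) - uu - ww - uw      ≡⟨ cong (λ t → t - uu - ww - uw) (sym expand) ⟩
    form u+w u+w - uu - ww - uw                 ≈⟨ sub-cong (sub-cong (sub-cong (alt u+w) (alt u)) (alt w)) ≋-refl ⟩
    + 0 - + 0 - + 0 - uw                        ≡⟨ zeros uw ⟩
    - uw                                        ∎
    where
    open import Relation.Binary.Reasoning.Setoid ≋-setoid
    uu uw wu ww : ℤ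
    uu = form u u
    uw = form u w
    wu = form w u
    ww = form w w
    u+w : Fin m → ℤ
    u+w i = u i + w i
    expand : form u+w u+w ≡ (uu + uw) + (wu + ww)
    expand = trans (form-+ˡ u w u+w) (cong₂ _+_ (form-+ʳ u u w) (form-+ʳ w u w))
    isolate : ∀ uu uw wu ww → wu ≡ ((uu + uw) + (wu + ww)) - uu - ww - uw
    isolate = solve-∀
    zeros : ∀ uw → + 0 - + 0 - + 0 - uw ≡ - uw
    zeros = solve-∀

module Frame {m : ℕ} (W : Fin m → Fin m → ℤ) (a b c : Fin m → ℤ) where
  open Bilinear W

  comb : ℤ³ → Fin m → ℤ
  comb ⟨ p , q , r ⟩ i = p · a i + q · b i + r · c i

  pairs copairs : (Fin m → ℤ) → ℤ³
  pairs u = ⟨ form u a , form u b , form u c ⟩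
  copairs w = ⟨ form a w , form b w , form c w ⟩

  Γ : Mat3
  Γ = rows (pairs a) (pairs b) (pairs c)

  comb-⊕ : ∀ k k' i → comb (k ⊕ k') i ≡ comb k i + comb k' i
  comb-⊕ ⟨ p , q , r ⟩ ⟨ p' , q' , r' ⟩ i = identity p q r p' q' r' (a i) (b i) (c i)
    where
    identity : ∀ p q r p' q' r' x y z →
      (p + p') · x + (q + q') · y + (r + r') · z ≡ (p · x + q · y + r · z) + (p' · x + q' · y + r' · z)
    identity = solve-∀

  comb-⊖ : ∀ k k' i → comb (k ⊖ k') i ≡ comb k i - comb k' i
  comb-⊖ ⟨ p , q , r ⟩ ⟨ p' , q' , r' ⟩ i = identity p q r p' q' r' (a i) (b i) (c i)
    where
    identity : ∀ p q r p' q' r' x y z →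
      (p - p') · x + (q - q') · y + (r - r') · z ≡ (p · x + q · y + r · z) - (p' · x + q' · y + r' · z)
    identity = solve-∀

  comb-⊛ : ∀ s k i → comb (s ⊛ k) i ≡ s · comb k i
  comb-⊛ s ⟨ p , q , r ⟩ i = identity s p q r (a i) (b i) (c i)
    where
    identity : ∀ s p q r x y z → s · p · x + s · q · y + s · r · z ≡ s · (p · x + q · y + r · z)
    identity = solve-∀

  comb-shift : ∀ k s y i → comb (k ⊕ s ⊛ y) i ≡ comb k i + s · comb y i
  comb-shift k s y i = trans (comb-⊕ k (s ⊛ y) i) (cong (_+_ (comb k i)) (comb-⊛ s y i))

  form-comb-right : ∀ u y → form u (comb y) ≡ pairs u ∙ y
  form-comb-right u ⟨ p , q , r ⟩ = begin
    form u (comb ⟨ p , q , r ⟩)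
      ≡⟨ form-+ʳ u (λ i → p · a i + q · b i) (λ i → r · c i) ⟩
    form u (λ i → p · a i + q · b i) + form u (λ i → r · c i)
      ≡⟨ cong₂ _+_ (trans (form-+ʳ u (λ i → p · a i) (λ i → q · b i))
                          (cong₂ _+_ (form-·ʳ u p a) (form-·ʳ u q b)))
                   (form-·ʳ u r c) ⟩
    form u a · p + form u b · q + form u c · r ∎
    where open ≡-Reasoning

  form-comb-left : ∀ k w → form (comb k) w ≡ k ∙ copairs w
  form-comb-left ⟨ p , q , r ⟩ w = begin
    form (comb ⟨ p , q , r ⟩) w
      ≡⟨ form-+ˡ (λ i → p · a i + q · b i) (λ i → r · c i) w ⟩
    form (λ i → p · a i + q · b i) w + form (λ i → r · c i) w
      ≡⟨ cong₂ _+_ (trans (form-+ˡ (λ i → p · a i) (λ i → q · b i) w)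
                          (cong₂ _+_ (form-·ˡ p a w) (form-·ˡ q b w)))
                   (form-·ˡ r c w) ⟩
    p · form a w + q · form b w + r · form c w ∎
    where open ≡-Reasoning

  form-comb : ∀ k y → form (comb k) (comb y) ≡ k ∙ (Γ ▷ y)
  form-comb k y = trans (form-comb-left k (comb y))
    (cong (k ∙_) (⟨⟩-cong (form-comb-right a y) (form-comb-right b y) (form-comb-right c y)))

  form-affine : ∀ v k y → form (λ i → v i + comb k i) (comb y) ≡ y ∙ pairs v + k ∙ (Γ ▷ y)
  form-affine v k y = trans (form-+ˡ v (comb k) (comb y))
    (cong₂ _+_ (trans (form-comb-right v y) (∙-comm (pairs v) y)) (form-comb k y))

module FrameModulo {m : ℕ} (W : Fin m → Fin m → ℤ) (M : ℤ) (a b c : Fin m → ℤ) where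
  open Bilinear W
  open BilinearModulo W M
  open Frame W a b c
  open Congruence M
  open import Relation.Binary.Reasoning.Setoid ≋-setoid

  transvℤ-comb : ∀ {x w} y k s → x ≈ comb y → w ≈ comb k → k ∙ (Γ ▷ y) ≋ s →
    transvℤ x w ≈ comb (k ⊕ s ⊛ y)
  transvℤ-comb {x} {w} y k s hx hw hs i = begin
    transvℤ x w i
      ≈⟨ transvℤ-cong hx hw i ⟩
    comb k i + form (comb k) (comb y) · comb y i
      ≈⟨ +-cong (≋-refl {comb k i}) (·-cong pairing ≋-refl) ⟩
    comb k i + s · comb y i
      ≡⟨ sym (comb-shift k s y i) ⟩
    comb (k ⊕ s ⊛ y) i ∎
    where
    pairing : form (comb k) (comb y) ≋ s
    pairing = ≋-trans (≋-reflexive (form-comb k y)) hs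

  transvℤ-affine : ∀ {x w} y v k s → x ≈ comb y → w ≈ (λ i → v i + comb k i) →
    y ∙ pairs v + k ∙ (Γ ▷ y) ≋ s → transvℤ x w ≈ (λ i → v i + comb (k ⊕ s ⊛ y) i)
  transvℤ-affine {x} {w} y v k s hx hw hs i = begin
    transvℤ x w i
      ≈⟨ transvℤ-cong hx hw i ⟩
    (v i + comb k i) + form v+k (comb y) · comb y i
      ≈⟨ +-cong (≋-refl {v i + comb k i}) (·-cong pairing ≋-refl) ⟩
    (v i + comb k i) + s · comb y i
      ≡⟨ +-assoc (v i) (comb k i) (s · comb y i) ⟩
    v i + (comb k i + s · comb y i)
      ≡⟨ cong (_+_ (v i)) (sym (comb-shift k s y i)) ⟩
    v i + comb (k ⊕ s ⊛ y) i ∎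
    where
    v+k : Fin m → ℤ
    v+k i = v i + comb k i
    pairing : form v+k (comb y) ≋ s
    pairing = ≋-trans (≋-reflexive (form-affine v k y)) hs

res-Σ₂ : ∀ m (f : Fin m → ℤ₂) n → res (Σ₂ m f) n ≡ sum (λ i → res (f i) n)
res-Σ₂ zero f n = refl
res-Σ₂ (suc m) f n = cong (_+_ (res (f zero) n)) (res-Σ₂ m (λ i → f (suc i)) n)

module Residues {m : ℕ} (ω : Gram m) (n : ℕ) where

  W : Fin m → Fin m → ℤ
  W i j = res (ω i j) n

  rn : Vec₂ m → Fin m → ℤ
  rn u i = res (u i) n

  open Bilinear W
  open Congruence (2^ n)

  res-form : ∀ u w → res (⟪ ω ⟫ u w) n ≡ form (rn u) (rn w)
  res-form u w = trans (res-Σ₂ m (λ i → Σ₂ m λ j → u i *₂ ω i j *₂ w j) n)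
    (sum-cong-≗ λ i → res-Σ₂ m (λ j → u i *₂ ω i j *₂ w j) n)

  res-transv : ∀ x w i → rn (transv ω x w) i ≡ transvℤ (rn x) (rn w) i
  res-transv x w i = cong (λ s → rn w i + s · rn x i) (res-form w x)

  res-pairing : ∀ u w z → ⟪ ω ⟫ u w ≈₂ ι z → form (rn u) (rn w) ≋ z
  res-pairing u w z h = by-divisibility (subst (λ t → 2^ n ∣ℤ t - z) (res-form u w) (h n))

  res-alternating : Alternating ω → ∀ u → form u u ≋ + 0
  res-alternating alt u = res-pairing (λ i → ι (u i)) (λ i → ι (u i)) (+ 0) (alt (λ i → ι (u i)))

module Configuration {m : ℕ} (ω : Gram m) (alt : Alternating ω) (a b c : Vec₂ m)
    (hab : ⟪ ω ⟫ a b ≈₂ ι (- (+ 1))) (hbc : ⟪ ω ⟫ b c ≈₂ ι (- (+ 1))) (hac : ⟪ ω ⟫ a c ≈₂ 0₂)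
    (n : ℕ) (v : Vec₂ m) where

  open Residues ω n
  open Congruence (2^ n)
  open Bilinear W
  open BilinearModulo W (2^ n)
  open Frame W (rn a) (rn b) (rn c)
  open FrameModulo W (2^ n) (rn a) (rn b) (rn c)

  G : Mat3
  G = rows ⟨ + 0 , - + 1 , + 0 ⟩ ⟨ + 1 , + 0 , - + 1 ⟩ ⟨ + 0 , + 1 , + 0 ⟩

  -- the hypotheses mod 2ⁿ, completed by antisymmetry, give the whole Gram matrix
  gram : Γ ≋ᴹ G
  gram = (alt' (rn a) , ab , ac) , (flip (rn a) (rn b) ab , alt' (rn b) , bc) ,
         (flip (rn a) (rn c) ac , flip (rn b) (rn c) bc , alt' (rn c))
    where
    alt' : ∀ u → form u u ≋ + 0
    alt' = res-alternating alt
    ab : form (rn a) (rn b) ≋ - + 1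
    ab = res-pairing a b (- + 1) hab
    bc : form (rn b) (rn c) ≋ - + 1
    bc = res-pairing b c (- + 1) hbc
    ac : form (rn a) (rn c) ≋ + 0
    ac = res-pairing a c (+ 0) hac
    flip : ∀ u w {z} → form u w ≋ z → form w u ≋ - z
    flip u w h = ≋-trans (form-antisym alt' u w) (neg-cong h)

  ν : ℤ³
  ν = pairs (rn v)

  infix 4 _≅_ _≅ₛ_

  record _≅_ (x : Vec₂ m) (y : ℤ³) : Set where
    constructor coordinates
    field
      ≅-≈ : rn x ≈ comb y

  record _≅ₛ_ (w : Vec₂ m) (K : Mat3) : Set where
    constructor state
    field
      ≅ₛ-≈ : rn w ≈ (λ i → rn v i + comb (K ▷ ν) i)

  e₁ e₂ e₃ : ℤ³
  e₁ = ⟨ + 1 , + 0 , + 0 ⟩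
  e₂ = ⟨ + 0 , + 1 , + 0 ⟩
  e₃ = ⟨ + 0 , + 0 , + 1 ⟩

  a≅ : a ≅ e₁
  a≅ = coordinates λ i → ≋-reflexive (identity (rn a i) (rn b i) (rn c i))
    where
    identity : ∀ x y z → x ≡ + 1 · x + + 0 · y + + 0 · z
    identity = solve-∀

  b≅ : b ≅ e₂
  b≅ = coordinates λ i → ≋-reflexive (identity (rn a i) (rn b i) (rn c i))
    where
    identity : ∀ x y z → y ≡ + 0 · x + + 1 · y + + 0 · z
    identity = solve-∀

  c≅ : c ≅ e₃
  c≅ = coordinates λ i → ≋-reflexive (identity (rn a i) (rn b i) (rn c i))
    where
    identity : ∀ x y z → z ≡ + 0 · x + + 0 · y + + 1 · z
    identity = solve-∀

  +ⱽ-≅ : ∀ {x z y k} → x ≅ y → z ≅ k → x +ⱽ z ≅ y ⊕ k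
  +ⱽ-≅ {y = y} {k} (coordinates hx) (coordinates hz) = coordinates λ i →
    ≋-trans (+-cong (hx i) (hz i)) (≋-reflexive (sym (comb-⊕ y k i)))

  -ⱽ-≅ : ∀ {x z y k} → x ≅ y → z ≅ k → x -ⱽ z ≅ y ⊖ k
  -ⱽ-≅ {y = y} {k} (coordinates hx) (coordinates hz) = coordinates λ i →
    ≋-trans (sub-cong (hx i) (hz i)) (≋-reflexive (sym (comb-⊖ y k i)))

  -- (x and z are explicit: inferring them would make Agda unfold transv)
  transv-≅ : ∀ x z {y k} → x ≅ y → z ≅ k → transv ω x z ≅ transvect G y k
  transv-≅ x z {y} {k} (coordinates hx) (coordinates hz) = coordinates λ i →
    ≋-trans (≋-reflexive (res-transv x z i)) (transvℤ-comb y k _ hx hz (∙-congʳ k (▷-cong gram y)) i)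

  v≅ₛ : v ≅ₛ 0ᴹ
  v≅ₛ = state λ i → ≋-reflexive (sym (+-identityʳ (rn v i)))

  transv-≅ₛ : ∀ {x w y K} → x ≅ y → w ≅ₛ K → transv ω x w ≅ₛ step G y K
  transv-≅ₛ {x} {w} {y} {K} (coordinates hx) (state hw) = state λ i → begin
    rn (transv ω x w) i              ≡⟨ res-transv x w i ⟩
    transvℤ (rn x) (rn w) i          ≈⟨ transvℤ-affine y (rn v) (K ▷ ν) s hx hw pairing i ⟩
    rn v i + comb (K ▷ ν ⊕ s ⊛ y) i  ≡⟨ cong (λ k → rn v i + comb k i) (sym (step-▷ G y K ν)) ⟩
    rn v i + comb (step G y K ▷ ν) i ∎
    where
    open import Relation.Binary.Reasoning.Setoid ≋-setoid
    s : ℤ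
    s = y ∙ ν + (K ▷ ν) ∙ (G ▷ y)
    pairing : y ∙ ν + (K ▷ ν) ∙ (Γ ▷ y) ≋ s
    pairing = +-cong (≋-refl {y ∙ ν}) (∙-congʳ (K ▷ ν) (▷-cong gram y))

  -- A squared transvection moves the state K to K' = step² K:  w ⟶⟨ x ⟩ K' by eq.
  -- The caller supplies K' explicitly, so that each use is a small closed
  -- computation.  (The implicit arguments are passed on explicitly:
  -- inferring them would make Agda unfold transv.)
  infixl 5 _⟶⟨_⟩_by_
  _⟶⟨_⟩_by_ : ∀ {x w y K} → w ≅ₛ K → x ≅ y → ∀ K' → step G y (step G y K) ≡ K' →
    transv² ω x w ≅ₛ K'
  _⟶⟨_⟩_by_ {x} {w} {y} {K} hw hx K' refl =
    transv-≅ₛ {x} {transv ω x w} {y} {step G y K} hx (transv-≅ₛ {x} {w} {y} {K} hx hw)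

  same-state : ∀ {w w' K} → w ≅ₛ K → w' ≅ₛ K → ∀ i → 2^ n ∣ℤ rn w i - rn w' i
  same-state (state h) (state h') i = divides (≋-trans (h i) (≋-sym (h' i)))

  -- Both words pass through the same states (read from the innermost
  -- transvection outwards); the rows are the coefficients of a, b, c as
  -- linear forms in ν = (⟨v,a⟩, ⟨v,b⟩, ⟨v,c⟩).
  after-c after-bc after-b after-abc after-ab : Mat3
  after-c   = rows ⟨ + 0 , + 0 , + 0 ⟩ ⟨ + 0 , + 0 , + 0 ⟩ ⟨ + 0 , + 0 , + 2 ⟩
  after-bc  = rows ⟨ + 0 , + 0 , + 0 ⟩ ⟨ + 0 , + 2 , + 2 ⟩ ⟨ + 0 , - + 2 , + 0 ⟩
  after-b   = rows ⟨ + 0 , + 0 , + 0 ⟩ ⟨ + 0 , + 0 , + 2 ⟩ ⟨ + 0 , - + 2 , + 0 ⟩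
  after-abc = rows ⟨ + 2 , + 2 , + 2 ⟩ ⟨ - + 2 , - + 2 , + 0 ⟩ ⟨ + 2 , + 0 , + 2 ⟩
  after-ab  = rows ⟨ + 0 , + 0 , + 2 ⟩ ⟨ + 0 , + 0 , + 0 ⟩ ⟨ + 2 , + 0 , + 2 ⟩

  -- the final state v ↦ v + 2 (⟨v,a⟩ + ⟨v,c⟩)(a + c), which is the action of t²_{a+c}
  t²ₐ₊c : Mat3
  t²ₐ₊c = rows ⟨ + 2 , + 0 , + 2 ⟩ ⟨ + 0 , + 0 , + 0 ⟩ ⟨ + 2 , + 0 , + 2 ⟩

  -- the frame coordinates of t_b(a) = a - b, t_c(t_b(a)) = a - b + c, t_c(b) = b - c
  tba≅ : transv ω b a ≅ transvect G e₂ e₁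
  tba≅ = transv-≅ b a b≅ a≅

  tctba≅ : transv ω c (transv ω b a) ≅ transvect G e₃ (transvect G e₂ e₁)
  tctba≅ = transv-≅ c (transv ω b a) c≅ tba≅

  tcb≅ : transv ω c b ≅ transvect G e₃ e₂
  tcb≅ = transv-≅ c b c≅ b≅

  first-word : transv² ω a (transv² ω (transv ω b a) (transv² ω (transv ω c (transv ω b a))
                (transv² ω b (transv² ω (transv ω c b) (transv² ω c v))))) ≅ₛ t²ₐ₊c
  first-word =
    v≅ₛ ⟶⟨ c≅ ⟩     after-c   by refl
        ⟶⟨ tcb≅ ⟩   after-bc  by refl
        ⟶⟨ b≅ ⟩     after-b   by refl
        ⟶⟨ tctba≅ ⟩ after-abc by refl
        ⟶⟨ tba≅ ⟩   after-ab  by refl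
        ⟶⟨ a≅ ⟩     t²ₐ₊c     by refl

  second-word : transv² ω a (transv² ω (a -ⱽ b) (transv² ω (a -ⱽ b +ⱽ c)
                 (transv² ω b (transv² ω (b -ⱽ c) (transv² ω c v))))) ≅ₛ t²ₐ₊c
  second-word =
    v≅ₛ ⟶⟨ c≅ ⟩                     after-c   by refl
        ⟶⟨ -ⱽ-≅ b≅ c≅ ⟩             after-bc  by refl
        ⟶⟨ b≅ ⟩                     after-b   by refl
        ⟶⟨ +ⱽ-≅ (-ⱽ-≅ a≅ b≅) c≅ ⟩   after-abc by refl
        ⟶⟨ -ⱽ-≅ a≅ b≅ ⟩             after-ab  by refl
        ⟶⟨ a≅ ⟩                     t²ₐ₊c     by refl

  square-of-a+c : transv² ω (a +ⱽ c) v ≅ₛ t²ₐ₊c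
  square-of-a+c = v≅ₛ ⟶⟨ +ⱽ-≅ a≅ c≅ ⟩ t²ₐ₊c by refl

lemma4p7 : (g : ℕ) (ω : Gram (2 * g)) → Alternating ω → NondegMod2 ω →
    (a b c : Vec₂ (2 * g)) → LinIndepMod2 a b c →
    ⟪ ω ⟫ a b ≈₂ ι (- (+ 1)) → ⟪ ω ⟫ b c ≈₂ ι (- (+ 1)) → ⟪ ω ⟫ a c ≈₂ 0₂ →
    (∀ v → (transv² ω a ∘ transv² ω (transv ω b a) ∘ transv² ω (transv ω c (transv ω b a))
              ∘ transv² ω b ∘ transv² ω (transv ω c b) ∘ transv² ω c) v
           ≈ⱽ (transv² ω a ∘ transv² ω (a -ⱽ b) ∘ transv² ω (a -ⱽ b +ⱽ c)
              ∘ transv² ω b ∘ transv² ω (b -ⱽ c) ∘ transv² ω c) v)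
    × (∀ v → (transv² ω a ∘ transv² ω (a -ⱽ b) ∘ transv² ω (a -ⱽ b +ⱽ c)
              ∘ transv² ω b ∘ transv² ω (b -ⱽ c) ∘ transv² ω c) v
           ≈ⱽ transv² ω (a +ⱽ c) v)
lemma4p7 g ω alt _ a b c _ hab hbc hac =
  (λ v i n → same-state n v (first-word n v) (second-word n v) i) ,
  (λ v i n → same-state n v (second-word n v) (square-of-a+c n v) i)
  where open Configuration ω alt a b c hab hbc hac
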